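{- Let $G$ be a finite graph of order $2k$ that is vertex-transitive, twin-free, and has co-twins, and let $\kappa:\mathrm{Aut}(G)\to S_k$ be the homomorphism sending $\alpha$ to the permutation it induces on the set of $k$ co-twin pairs. Let $\beta:V(G)\to V(G)$ be the map that interchanges the two vertices of every co-twin pair. Then $\ker\kappa=\langle\beta\rangle$.
   Context: $N(u)$ is the open and $N[u]=N(u)\cup\{u\}$ the closed neighborhood of $u$. A graph is twin-free if no two distinct vertices have equal open neighborhoods and no two distinct vertices have equal closed neighborhoods. Co-twins means nonadjacent co-twins: distinct vertices $u,v$ with $N[u]\cap N[v]=\emptyset$ and $N[u]\cup N[v]=V(G)$. In such a graph each vertex has exactly one co-twin, so $V(G)$ is partitioned into $k$ co-twin pairs, and automorphisms map co-twin pairs to co-twin pairs; $S_k$ is identified with the symmetric group on the set of co-twin pairs. -}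

module Defs where

open import Data.Nat using (ℕ; _*_)
open import Data.Fin using (Fin)
open import Data.Bool using (Bool; true; false)
open import Data.Product using (_×_; ∃; Σ)
open import Data.Sum using (_⊎_)
open import Relation.Nullary using (¬_)
open import Relation.Binary.PropositionalEquality using (_≡_; _≢_)
open import Function.Bundles using (_⇔_)
open import Function.Definitions using (Bijective)

record Graph (n : ℕ) : Set where
  field
    adj   : Fin n → Fin n → Bool
    sym   : ∀ u v → adj u v ≡ adj v u
    irrfl : ∀ u → adj u u ≡ false

module _ {n : ℕ} (G : Graph n) where
  open Graph G

  Adj : Fin n → Fin n → Set
  Adj u w = adj u w ≡ true

  InOpenNbhd : Fin n → Fin n → Set
  InOpenNbhd u w = Adj u w

  InClosedNbhd : Fin n → Fin n → Set
  InClosedNbhd u w = InOpenNbhd u w ⊎ w ≡ u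

  SameOpenNbhd : Fin n → Fin n → Set
  SameOpenNbhd u v = ∀ w → InOpenNbhd u w ⇔ InOpenNbhd v w

  SameClosedNbhd : Fin n → Fin n → Set
  SameClosedNbhd u v = ∀ w → InClosedNbhd u w ⇔ InClosedNbhd v w

  TwinFree : Set
  TwinFree = ∀ u v → u ≢ v → ¬ SameOpenNbhd u v × ¬ SameClosedNbhd u v

  CoTwins : Fin n → Fin n → Set
  CoTwins u v = u ≢ v
              × (∀ w → ¬ (InClosedNbhd u w × InClosedNbhd v w))
              × (∀ w → InClosedNbhd u w ⊎ InClosedNbhd v w)

  HasCoTwins : Set
  HasCoTwins = ∀ u → ∃ λ v → CoTwins u v

  IsAut : (Fin n → Fin n) → Set
  IsAut α = Bijective _≡_ _≡_ α × (∀ u v → adj (α u) (α v) ≡ adj u v)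

  VertexTransitive : Set
  VertexTransitive = ∀ u v → ∃ λ α → IsAut α × α u ≡ v

  -- α induces the identity permutation on the set of co-twin pairs:
  -- every co-twin pair {u,v} is mapped onto itself.
  FixesCoTwinPairs : (Fin n → Fin n) → Set
  FixesCoTwinPairs α = ∀ u v → CoTwins u v →
    (α u ≡ u × α v ≡ v) ⊎ (α u ≡ v × α v ≡ u)

  InKerκ : (Fin n → Fin n) → Set
  InKerκ α = IsAut α × FixesCoTwinPairs α

  IsCoTwinSwap : (Fin n → Fin n) → Set
  IsCoTwinSwap α = ∀ u → CoTwins u (α u)

  -- α ∈ ⟨β⟩ = {id, β}
  InGenβ : (Fin n → Fin n) → Set
  InGenβ α = (∀ u → α u ≡ u) ⊎ IsCoTwinSwap α

{-# OPTIONS --safe #-}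
-- Both co-twins of u have closed neighbourhood V ∖ N[u], so twin-freeness makes
-- co-twins unique and the swap β well defined.  A vertex outside a co-twin pair
-- {w, c} is adjacent to exactly one of w and c.  Hence β preserves adjacency,
-- and an automorphism fixing every pair cannot fix a vertex u while swapping a
-- pair {w, c}: then uw and uc would have the same edge status.  So an element
-- of ker κ either fixes every vertex or swaps every pair.
module Submission where

open import Defs
open import Data.Nat using (ℕ; _*_)
open import Data.Fin using (Fin)
open import Data.Fin.Properties using (_≟_; all?; ¬∀⟶∃¬)
open import Data.Bool using (true; false; not)
open import Data.Bool.Properties using (not-involutive; not-¬)
open import Data.Product using (_,_; proj₁; proj₂)
open import Data.Sum using (inj₁; inj₂; [_,_])
open import Data.Empty using (⊥-elim)
open import Relation.Nullary using (¬_; yes; no)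
open import Relation.Binary.PropositionalEquality
  using (_≡_; _≢_; refl; sym; trans; cong; cong₂; subst; module ≡-Reasoning)
open import Function.Bundles using (_⇔_; mk⇔)
open import Function.Definitions using (Bijective)

involutive⇒bijective : {A : Set} {f : A → A} → (∀ x → f (f x) ≡ x) →
                       Bijective _≡_ _≡_ f
involutive⇒bijective {f = f} inv = inverseᵇ⇒bijective
  (strictlyInverseˡ⇒inverseˡ f inv , strictlyInverseʳ⇒inverseʳ f inv)
  where open import Function.Consequences.Propositional

module _ {n : ℕ} (G : Graph n) where
  open Graph G using (adj; irrfl) renaming (sym to adj-sym)
  open ≡-Reasoning

  coTwins-sym : ∀ {u v} → CoTwins G u v → CoTwins G v u
  coTwins-sym (u≢v , disjoint , cover) =
      (λ v≡u → u≢v (sym v≡u))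
    , (λ w (v~w , u~w) → disjoint w (u~w , v~w))
    , (λ w → Data.Sum.swap (cover w))

  coTwin-closedNbhd-⊆ : ∀ {u a b} → CoTwins G u a → CoTwins G u b →
                        ∀ w → InClosedNbhd G a w → InClosedNbhd G b w
  coTwin-closedNbhd-⊆ (_ , disjoint , _) (_ , _ , cover) w a~w with cover w
  ... | inj₁ u~w = ⊥-elim (disjoint w (u~w , a~w))
  ... | inj₂ b~w = b~w

  coTwin-unique : TwinFree G → ∀ {u v v′} →
                  CoTwins G u v → CoTwins G u v′ → v ≡ v′
  coTwin-unique twinFree {v = v} {v′} u~v u~v′ with v ≟ v′
  ... | yes v≡v′ = v≡v′
  ... | no v≢v′ = ⊥-elim (proj₂ (twinFree v v′ v≢v′) λ w →
          mk⇔ (coTwin-closedNbhd-⊆ u~v u~v′ w) (coTwin-closedNbhd-⊆ u~v′ u~v w))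

  ¬closedNbhd : ∀ {w u} → u ≢ w → adj w u ≡ false → ¬ InClosedNbhd G w u
  ¬closedNbhd u≢w w≁u (inj₁ w~u) with () ← trans (sym w≁u) w~u
  ¬closedNbhd u≢w w≁u (inj₂ u≡w) = u≢w u≡w

  coTwins-adj-not : ∀ {w c u} → CoTwins G w c → u ≢ w → u ≢ c →
                    adj w u ≡ not (adj c u)
  coTwins-adj-not {w} {c} {u} (_ , disjoint , cover) u≢w u≢c
    with adj w u in wu | adj c u in cu
  ... | true  | true  = ⊥-elim (disjoint u (inj₁ wu , inj₁ cu))
  ... | true  | false = refl
  ... | false | true  = refl
  ... | false | false = ⊥-elim ([ ¬closedNbhd u≢w wu , ¬closedNbhd u≢c cu ] (cover u))

  module _ (twinFree : TwinFree G) {β : Fin n → Fin n} (swap : IsCoTwinSwap G β) where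

    coTwinSwap-involutive : ∀ u → β (β u) ≡ u
    coTwinSwap-involutive u = coTwin-unique twinFree (swap (β u)) (coTwins-sym (swap u))

    coTwinSwap-bijective : Bijective _≡_ _≡_ β
    coTwinSwap-bijective = involutive⇒bijective coTwinSwap-involutive

    coTwinSwap-preserves-adj : ∀ u v → adj (β u) (β v) ≡ adj u v
    coTwinSwap-preserves-adj u v with u ≟ v | u ≟ β v
    ... | yes refl | _ = trans (irrfl (β u)) (sym (irrfl u))
    ... | no _ | yes refl =
      trans (cong (λ x → adj x (β v)) (coTwinSwap-involutive v)) (adj-sym v (β v))
    ... | no u≢v | no u≢βv = sym (begin
      adj u v                   ≡⟨ adj-sym u v ⟩
      adj v u                   ≡⟨ coTwins-adj-not (swap v) u≢v u≢βv ⟩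
      not (adj (β v) u)         ≡⟨ cong not (adj-sym (β v) u) ⟩
      not (adj u (β v))         ≡⟨ cong not (coTwins-adj-not (swap u) βv≢u βv≢βu) ⟩
      not (not (adj (β u) (β v))) ≡⟨ not-involutive _ ⟩
      adj (β u) (β v)           ∎)
      where
      βv≢u : β v ≢ u
      βv≢u βv≡u = u≢βv (sym βv≡u)
      βv≢βu : β v ≢ β u
      βv≢βu βv≡βu = u≢v (sym (proj₁ coTwinSwap-bijective βv≡βu))

    coTwinSwap-inKerκ : InKerκ G β
    coTwinSwap-inKerκ = (coTwinSwap-bijective , coTwinSwap-preserves-adj) , λ u v u~v →
      inj₂ ( coTwin-unique twinFree (swap u) u~v
           , coTwin-unique twinFree (swap v) (coTwins-sym u~v))

  identity-inKerκ : ∀ {α} → (∀ u → α u ≡ u) → InKerκ G α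
  identity-inKerκ {α} α≗id =
    ( involutive⇒bijective (λ u → trans (α≗id (α u)) (α≗id u))
    , λ u v → cong₂ adj (α≗id u) (α≗id v))
    , λ u v _ → inj₁ (α≗id u , α≗id v)

  swapped-pair⇒no-fixed-point : ∀ {α : Fin n → Fin n} {w c} →
    (∀ u v → adj (α u) (α v) ≡ adj u v) →
    CoTwins G w c → α w ≡ c → α c ≡ w → ∀ u → α u ≢ u
  swapped-pair⇒no-fixed-point {α} {w} {c} preserves w~c@(w≢c , _) αw≡c αc≡w
                              u αu≡u with u ≟ w | u ≟ c
  ... | yes refl | _ = w≢c (trans (sym αu≡u) αw≡c)
  ... | no _ | yes refl = w≢c (sym (trans (sym αu≡u) αc≡w))
  ... | no u≢w | no u≢c = not-¬ w~u≡c~u (coTwins-adj-not w~c u≢w u≢c)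
    where
    w~u≡c~u : adj w u ≡ adj c u
    w~u≡c~u = begin
      adj w u         ≡⟨ adj-sym w u ⟩
      adj u w         ≡⟨ sym (preserves u w) ⟩
      adj (α u) (α w) ≡⟨ cong₂ adj αu≡u αw≡c ⟩
      adj u c         ≡⟨ adj-sym u c ⟩
      adj c u         ∎

  moved⇒isCoTwinSwap : HasCoTwins G → ∀ {α w} →
                       InKerκ G α → α w ≢ w → IsCoTwinSwap G α
  moved⇒isCoTwinSwap hasCoTwins {w = w} ((_ , preserves) , fixesPairs) αw≢w u
    with fixesPairs w _ (proj₂ (hasCoTwins w)) | fixesPairs u _ (proj₂ (hasCoTwins u))
  ... | inj₁ (αw≡w , _) | _ = ⊥-elim (αw≢w αw≡w)
  ... | inj₂ (αw≡c , αc≡w) | inj₁ (αu≡u , _) =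
    ⊥-elim (swapped-pair⇒no-fixed-point preserves (proj₂ (hasCoTwins w))
                                        αw≡c αc≡w u αu≡u)
  ... | inj₂ _ | inj₂ (αu≡v , _) = subst (CoTwins G u) (sym αu≡v) (proj₂ (hasCoTwins u))

  inKerκ⇒inGenβ : HasCoTwins G → ∀ {α} → InKerκ G α → InGenβ G α
  inKerκ⇒inGenβ hasCoTwins {α} inKer with all? (λ u → α u ≟ u)
  ... | yes α≗id = inj₁ α≗id
  ... | no α≉id = inj₂ (moved⇒isCoTwinSwap hasCoTwins inKer
                          (proj₂ (¬∀⟶∃¬ n _ (λ u → α u ≟ u) α≉id)))

  inGenβ⇒inKerκ : TwinFree G → ∀ {α} → InGenβ G α → InKerκ G α
  inGenβ⇒inKerκ _ (inj₁ α≗id) = identity-inKerκ α≗id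
  inGenβ⇒inKerκ twinFree (inj₂ swap) = coTwinSwap-inKerκ twinFree swap

lemma35 : (k : ℕ) (G : Graph (2 * k)) →
    VertexTransitive G → TwinFree G → HasCoTwins G →
    ∀ (α : Fin (2 * k) → Fin (2 * k)) → InKerκ G α ⇔ InGenβ G α
lemma35 k G _ twinFree hasCoTwins α =
  mk⇔ (inKerκ⇒inGenβ G hasCoTwins) (inGenβ⇒inKerκ G twinFree)
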